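{- For a positive integer $n$, let $z(n)$ be the largest integer with $3z(n)<2n$, let $m(n)$ be the largest integer with $m(n)^2\le 2n$, let $r(n)$ be the least non-negative integer with $n\le 2^{r(n)}$, and put $c(n)=2n-2z(n)+2$ and $y(n)=2^{c(n)-m(n)}-n^{m(n)-1}$. Let $n$ be a positive integer, $s=r(n)$ and $t=m(n)$. Then: (i) if $c(n)\le s(t-1)+1$, then $y(n)<0$; (ii) if $c(n)>s(t-1)+t$, then $y(n)>0$. -}

module Defs where

open import Data.Nat using (ℕ; zero; suc; _+_; _*_; _∸_; _^_; _≤_; _<_)
open import Data.Integer as ℤ using (ℤ; +_; _-_)
open import Data.Product using (_×_)

IsZ : ℕ → ℕ → Set
IsZ n z = (3 * z < 2 * n) × (∀ k → 3 * k < 2 * n → k ≤ z)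

IsM : ℕ → ℕ → Set
IsM n m = (m * m ≤ 2 * n) × (∀ k → k * k ≤ 2 * n → k ≤ m)

IsR : ℕ → ℕ → Set
IsR n r = (n ≤ 2 ^ r) × (∀ k → n ≤ 2 ^ k → r ≤ k)

-- c(n) = 2n - 2z(n) + 2  (non-negative since 3z < 2n)
cval : ℕ → ℕ → ℕ
cval n z = 2 * n ∸ 2 * z + 2

-- y(n) = 2^(c - m) - n^(m - 1), as an integer.
-- (c ≥ m and m ≥ 1 always hold for n ≥ 1, so the natural-number
--  exponents are exact.)
yval : ℕ → ℕ → ℕ → ℤ
yval n c m = + (2 ^ (c ∸ m)) - + (n ^ (m ∸ 1))

-- Only the crude bounds c(n) ≥ 2 and 2^(s-1) < n ≤ 2^s are needed.  For (ii),
-- n^(t-1) ≤ 2^(s(t-1)) < 2^(c-t).  For (i), c ≥ 2 forces t ≥ 2, hence n ≥ 2 and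
-- s ≥ 1, and then 2^(c-t) ≤ 2^((s-1)(t-1)) < n^(t-1).
module Submission where

open import Defs
open import Data.Nat using (ℕ; zero; suc; _+_; _*_; _∸_; _^_; _≤_; _≰_; _<_; z≤n; s≤s; NonZero)
open import Data.Nat.Properties
open import Data.Integer as ℤ using (+<+)
import Data.Integer.Properties as ℤ
open import Data.Product using (_×_; _,_)
open import Data.Empty using (⊥-elim)
open import Relation.Binary.PropositionalEquality using (subst)

i<j⇒i-j<0 : ∀ {i j} → i ℤ.< j → i ℤ.- j ℤ.< ℤ.0ℤ
i<j⇒i-j<0 {i} {j} i<j = subst (i ℤ.- j ℤ.<_) (ℤ.+-inverseʳ j) (ℤ.+-monoˡ-< (ℤ.- j) i<j)

j<i⇒0<i-j : ∀ {i j} → j ℤ.< i → ℤ.0ℤ ℤ.< i ℤ.- j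
j<i⇒0<i-j {i} {j} j<i = subst (ℤ._< i ℤ.- j) (ℤ.+-inverseʳ j) (ℤ.+-monoˡ-< (ℤ.- j) j<i)

n≤b^s⇒n^k≤b^[s*k] : ∀ {n} b s k → n ≤ b ^ s → n ^ k ≤ b ^ (s * k)
n≤b^s⇒n^k≤b^[s*k] {n} b s k n≤b^s = begin
  n ^ k        ≤⟨ ^-monoˡ-≤ k n≤b^s ⟩
  (b ^ s) ^ k  ≡⟨ ^-*-assoc b s k ⟩
  b ^ (s * k)  ∎
  where open ≤-Reasoning

b^s<n⇒b^[s*k]<n^k : ∀ {n} b s k .{{_ : NonZero k}} → b ^ s < n → b ^ (s * k) < n ^ k
b^s<n⇒b^[s*k]<n^k {n} b s k b^s<n = begin-strict
  b ^ (s * k)  ≡⟨ ^-*-assoc b s k ⟨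
  (b ^ s) ^ k  <⟨ ^-monoˡ-< k b^s<n ⟩
  n ^ k        ∎
  where open ≤-Reasoning

IsR-suc⇒2^<n : ∀ {n s} → IsR n (suc s) → 2 ^ s < n
IsR-suc⇒2^<n (_ , least) = ≰⇒> λ n≤2^s → 1+n≰n (least _ n≤2^s)

2≤m⇒m*m≤2*n⇒2≤n : ∀ {m n} → 2 ≤ m → m * m ≤ 2 * n → 2 ≤ n
2≤m⇒m*m≤2*n⇒2≤n {m} 2≤m m*m≤2n = *-cancelˡ-≤ 2 (≤-trans (*-mono-≤ 2≤m 2≤m) m*m≤2n)

2≤cval : ∀ n z → 2 ≤ cval n z
2≤cval n z = m≤n+m 2 (2 * n ∸ 2 * z)

c≤[1+s]*k+1⇒c∸[1+k]≤s*k : ∀ {c} s k → c ≤ suc s * k + 1 → c ∸ suc k ≤ s * k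
c≤[1+s]*k+1⇒c∸[1+k]≤s*k {c} s k c≤ =
  m≤n+o⇒m∸n≤o c (suc k) (subst (c ≤_) (+-comm (suc s * k) 1) c≤)

2≤c⇒c≰s*0+1 : ∀ {c} s → 2 ≤ c → c ≰ s * 0 + 1
2≤c⇒c≰s*0+1 {c} s 2≤c c≤ = ≤⇒≯ (subst (λ x → c ≤ x + 1) (*-zeroʳ s) c≤) 2≤c

2^[c∸m]<n^[m∸1] : ∀ {n c m s} → 2 ≤ c → m * m ≤ 2 * n → IsR n s →
                  c ≤ s * (m ∸ 1) + 1 → 2 ^ (c ∸ m) < n ^ (m ∸ 1)
2^[c∸m]<n^[m∸1] {m = 0}     {s} 2≤c _ _ c≤ = ⊥-elim (2≤c⇒c≰s*0+1 s 2≤c c≤)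
2^[c∸m]<n^[m∸1] {m = 1}     {s} 2≤c _ _ c≤ = ⊥-elim (2≤c⇒c≰s*0+1 s 2≤c c≤)
2^[c∸m]<n^[m∸1] {m = suc (suc t)} {zero} _ m*m≤2n (n≤1 , _) _ =
  ⊥-elim (≤⇒≯ n≤1 (2≤m⇒m*m≤2*n⇒2≤n {suc (suc t)} (s≤s (s≤s z≤n)) m*m≤2n))
2^[c∸m]<n^[m∸1] {n} {c} {suc (suc t)} {suc s} _ _ isR c≤ = begin-strict
  2 ^ (c ∸ suc (suc t))  ≤⟨ ^-monoʳ-≤ 2 (c≤[1+s]*k+1⇒c∸[1+k]≤s*k s (suc t) c≤) ⟩
  2 ^ (s * suc t)        <⟨ b^s<n⇒b^[s*k]<n^k 2 s (suc t) (IsR-suc⇒2^<n isR) ⟩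
  n ^ suc t              ∎
  where open ≤-Reasoning

n^[m∸1]<2^[c∸m] : ∀ {n c m s} → n ≤ 2 ^ s → s * (m ∸ 1) + m < c → n ^ (m ∸ 1) < 2 ^ (c ∸ m)
n^[m∸1]<2^[c∸m] {n} {c} {m} {s} n≤2^s c> = begin-strict
  n ^ (m ∸ 1)        ≤⟨ n≤b^s⇒n^k≤b^[s*k] 2 s (m ∸ 1) n≤2^s ⟩
  2 ^ (s * (m ∸ 1))  <⟨ ^-monoʳ-< 2 ≤-refl (m+n≤o⇒m≤o∸n (suc (s * (m ∸ 1))) {m} c>) ⟩
  2 ^ (c ∸ m)        ∎
  where open ≤-Reasoning

-- Neither 1 ≤ n nor the value of z is needed: c(n) ≥ 2 holds for every z.
lemma2p4 : ∀ (n z m s : ℕ) → 1 ≤ n → IsZ n z → IsM n m → IsR n s →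
             (cval n z ≤ s * (m ∸ 1) + 1 → yval n (cval n z) m ℤ.< ℤ.0ℤ)
           × (s * (m ∸ 1) + m < cval n z → ℤ.0ℤ ℤ.< yval n (cval n z) m)
lemma2p4 n z m s _ _ (m*m≤2n , _) isR@(n≤2^s , _) =
    (λ c≤ → i<j⇒i-j<0 (+<+ (2^[c∸m]<n^[m∸1] {n} {c} {m} {s} (2≤cval n z) m*m≤2n isR c≤)))
  , (λ c> → j<i⇒0<i-j (+<+ (n^[m∸1]<2^[c∸m] {n} {c} {m} {s} n≤2^s c>)))
  where
  c : ℕ
  c = cval n z
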